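{- Let $\Psi$ be an arbitrary complex unit gain graph, with gain matrix written in block form as $A(\Psi)=\begin{bmatrix}0 & a\\ a^* & A'\end{bmatrix}$ (where $a$ is a row vector and $A'$ a square matrix). Then the gain graph $\hat{\Psi}$ with gain matrix \[A(\hat{\Psi})=\begin{bmatrix}0 & a & -a\\ a^* & A' & O\\ -a^* & O & -A'\end{bmatrix}\] is sign-symmetric.
   Context: $\mathbb{T}=\{z\in\mathbb{C}:|z|=1\}$. A complex unit gain graph $\Psi=(G,\psi)$ consists of a finite simple graph $G$ and a map $\psi$ assigning to each ordered pair $(u,v)$ with $uv$ an edge a value $\psi(uv)\in\mathbb{T}$, with $\psi(vu)=\psi(uv)^{ -1}$; its gain matrix $A(\Psi)$ is the Hermitian matrix with $A_{uv}=\psi(uv)$ for edges and $0$ otherwise; any Hermitian matrix with zero diagonal and entries in $\mathbb{T}\cup\{0\}$ is the gain matrix of a gain graph. The negation is $-\Psi=(G,-\psi)$. $\Psi\sim\Psi'$ (switching isomorphic) if $A(\Psi')$ is obtained from $A(\Psi)$ by $A\mapsto XAX^{ -1}$ with $X$ diagonal with entries in $\mathbb{T}$, possibly followed by taking the converse ($A\mapsto A^\top$) and/or relabeling vertices ($A\mapsto PAP^{ -1}$, $P$ a permutation matrix). $\Psi$ is sign-symmetric if $\Psi\sim-\Psi$. -}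

module Defs where

open import Level using (Level; _⊔_)
open import Algebra.Bundles using (AbelianGroup)
open import Data.Nat using (ℕ; suc; _+_)
open import Data.Fin using (Fin; zero; suc; splitAt)
open import Data.Fin.Permutation using (Permutation′; _⟨$⟩ʳ_)
open import Data.Maybe using (Maybe; just; nothing)
import Data.Maybe as Maybe
open import Data.Maybe.Relation.Binary.Pointwise using (Pointwise)
open import Data.Bool using (Bool; true; false)
open import Data.Sum using (inj₁; inj₂)
open import Data.Product using (Σ; ∃; _×_)

-- The gain group 𝕋 is modelled abstractly as an abelian group (written
-- multiplicatively: _∙_, ε, _⁻¹) together with a distinguished element
-- `m1` playing the role of -1 ∈ 𝕋.  A matrix entry is `Maybe Carrier`:
-- `nothing` = 0 (non-edge), `just g` = gain g ∈ 𝕋.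
module Gain {c ℓ : Level} (𝕋 : AbelianGroup c ℓ) (m1 : AbelianGroup.Carrier 𝕋) where
  open AbelianGroup 𝕋

  Entry : Set c
  Entry = Maybe Carrier

  _≈ₑ_ : Entry → Entry → Set (c ⊔ ℓ)
  _≈ₑ_ = Pointwise _≈_

  Mat : ℕ → Set c
  Mat n = Fin n → Fin n → Entry

  -- entrywise inverse = complex conjugation on 𝕋 ∪ {0}
  conj : Entry → Entry
  conj = Maybe.map _⁻¹

  negₑ : Entry → Entry
  negₑ = Maybe.map (m1 ∙_)

  IsGainMatrix : ∀ {n} → Mat n → Set (c ⊔ ℓ)
  IsGainMatrix A = (∀ i → A i i ≈ₑ nothing) × (∀ i j → A j i ≈ₑ conj (A i j))

  negMat : ∀ {n} → Mat n → Mat n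
  negMat A i j = negₑ (A i j)

  switch : ∀ {n} → (Fin n → Carrier) → Mat n → Mat n
  switch x A i j = Maybe.map (λ g → (x i ∙ g) ∙ (x j ⁻¹)) (A i j)

  conv : ∀ {n} → Bool → Mat n → Mat n
  conv false A = A
  conv true  A i j = A j i

  relabel : ∀ {n} → Permutation′ n → Mat n → Mat n
  relabel σ A i j = A (σ ⟨$⟩ʳ i) (σ ⟨$⟩ʳ j)

  _∼_ : ∀ {n} → Mat n → Mat n → Set (c ⊔ ℓ)
  _∼_ {n} A B = Σ (Fin n → Carrier) λ x → Σ Bool λ b → Σ (Permutation′ n) λ σ →
    ∀ i j → B i j ≈ₑ relabel σ (conv b (switch x A)) i j

  SignSymmetric : ∀ {n} → Mat n → Set (c ⊔ ℓ)
  SignSymmetric A = A ∼ negMat A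

  -- Given A(Ψ) = [[0, a], [a*, A']] on vertex set Fin (suc m)
  -- (vertex zero first, then Fin m), build
  -- A(Ψ̂) = [[0, a, -a], [a*, A', O], [-a*, O, -A']] on Fin (suc (m + m)).
  hat : ∀ {m} → Mat (suc m) → Mat (suc (m + m))
  hat         A zero    zero    = nothing
  hat {m}     A zero    (suc j) with splitAt m j
  ... | inj₁ k = A zero (suc k)
  ... | inj₂ k = negₑ (A zero (suc k))
  hat {m}     A (suc i) zero    with splitAt m i
  ... | inj₁ k = A (suc k) zero
  ... | inj₂ k = negₑ (A (suc k) zero)
  hat {m}     A (suc i) (suc j) with splitAt m i | splitAt m j
  ... | inj₁ k | inj₁ l = A (suc k) (suc l)
  ... | inj₁ k | inj₂ l = nothing
  ... | inj₂ k | inj₁ l = nothing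
  ... | inj₂ k | inj₂ l = negₑ (A (suc k) (suc l))

{-# OPTIONS --safe #-}
-- With trivial switching, relabel Ψ̂ by the involution that fixes the first
-- vertex and exchanges the two copies of the remaining vertices.  It swaps
-- the blocks a ↔ -a and A' ↔ -A' and fixes the zero blocks, so since
-- (-1)(-1) = 1 every entry of the relabelled matrix is the negated entry.
module Submission where

open import Defs
open import Algebra.Bundles using (AbelianGroup)
open import Data.Nat using (ℕ; suc; _+_)
open import Data.Fin using (Fin; zero; suc; splitAt)
open import Data.Fin.Properties using (+↔⊎; splitAt-join)
open import Data.Fin.Permutation using (Permutation; Permutation′; lift₀; _⟨$⟩ʳ_)
open import Data.Sum using (inj₁; inj₂; swap)
open import Data.Sum.Algebra using (⊎-comm)
open import Data.Maybe using (just; nothing)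
open import Data.Maybe.Relation.Binary.Pointwise using (just; nothing)
import Data.Maybe.Relation.Binary.Pointwise as Pointwise
open import Data.Bool using (false)
open import Data.Product using (_,_)
open import Function.Properties.Inverse using (↔-sym; ↔-trans)
open import Relation.Binary.PropositionalEquality using (_≡_)
import Algebra.Properties.Group as GroupProperties

swapHalves : ∀ m n → Permutation (m + n) (n + m)
swapHalves m n = ↔-trans +↔⊎ (↔-trans (⊎-comm (Fin m) (Fin n)) (↔-sym +↔⊎))

splitAt-swapHalves : ∀ m n i → splitAt n (swapHalves m n ⟨$⟩ʳ i) ≡ swap (splitAt m i)
splitAt-swapHalves m n i = splitAt-join n m (swap (splitAt m i))

swapCopies : ∀ m → Permutation′ (suc (m + m))
swapCopies m = lift₀ (swapHalves m m)

module _ {c ℓ} (𝕋 : AbelianGroup c ℓ) (m1 : AbelianGroup.Carrier 𝕋) where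
  open AbelianGroup 𝕋
  open Gain 𝕋 m1
  open GroupProperties group using (ε⁻¹≈ε)
  open import Relation.Binary.Reasoning.Setoid setoid

  ≈ₑ-refl : ∀ {e} → e ≈ₑ e
  ≈ₑ-refl = Pointwise.refl refl

  ≈ₑ-trans : ∀ {d e f} → d ≈ₑ e → e ≈ₑ f → d ≈ₑ f
  ≈ₑ-trans = Pointwise.trans trans

  switch-trivial : ∀ {n} (A : Mat n) i j → A i j ≈ₑ switch (λ _ → ε) A i j
  switch-trivial A i j with A i j
  ... | nothing = nothing
  ... | just g  = just (sym (begin
    (ε ∙ g) ∙ ε ⁻¹ ≈⟨ ∙-cong (identityˡ g) ε⁻¹≈ε ⟩
    g ∙ ε          ≈⟨ identityʳ g ⟩
    g              ∎))

  module _ (m1²≈ε : m1 ∙ m1 ≈ ε) where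

    negₑ-involutive : ∀ e → negₑ (negₑ e) ≈ₑ e
    negₑ-involutive nothing  = nothing
    negₑ-involutive (just g) = just (begin
      m1 ∙ (m1 ∙ g) ≈⟨ assoc m1 m1 g ⟨
      (m1 ∙ m1) ∙ g ≈⟨ ∙-congʳ m1²≈ε ⟩
      ε ∙ g         ≈⟨ identityˡ g ⟩
      g             ∎)

    negMat-hat-swapCopies : ∀ {m} (A : Mat (suc m)) i j →
      negMat (hat A) i j ≈ₑ relabel (swapCopies m) (hat A) i j
    negMat-hat-swapCopies A zero zero = nothing
    negMat-hat-swapCopies {m} A zero (suc j)
      rewrite splitAt-swapHalves m m j with splitAt m j
    ... | inj₁ k = ≈ₑ-refl
    ... | inj₂ k = negₑ-involutive (A zero (suc k))
    negMat-hat-swapCopies {m} A (suc i) zero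
      rewrite splitAt-swapHalves m m i with splitAt m i
    ... | inj₁ k = ≈ₑ-refl
    ... | inj₂ k = negₑ-involutive (A (suc k) zero)
    negMat-hat-swapCopies {m} A (suc i) (suc j)
      rewrite splitAt-swapHalves m m i | splitAt-swapHalves m m j
      with splitAt m i | splitAt m j
    ... | inj₁ k | inj₁ l = ≈ₑ-refl
    ... | inj₁ k | inj₂ l = nothing
    ... | inj₂ k | inj₁ l = nothing
    ... | inj₂ k | inj₂ l = negₑ-involutive (A (suc k) (suc l))

    hat-signSymmetric : ∀ {m} (A : Mat (suc m)) → SignSymmetric (hat A)
    hat-signSymmetric {m} A = (λ _ → ε) , false , swapCopies m , λ i j →
      ≈ₑ-trans (negMat-hat-swapCopies A i j)
               (switch-trivial (hat A) (swapCopies m ⟨$⟩ʳ i) (swapCopies m ⟨$⟩ʳ j))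

lemma4p3 : ∀ {c ℓ} (𝕋 : AbelianGroup c ℓ) (m1 : AbelianGroup.Carrier 𝕋) →
    AbelianGroup._≈_ 𝕋 (AbelianGroup._∙_ 𝕋 m1 m1) (AbelianGroup.ε 𝕋) →
    (m : ℕ) (A : Gain.Mat 𝕋 m1 (suc m)) → Gain.IsGainMatrix 𝕋 m1 A →
    Gain.SignSymmetric 𝕋 m1 (Gain.hat 𝕋 m1 A)
lemma4p3 𝕋 m1 m1²≈ε m A _ = hat-signSymmetric 𝕋 m1 m1²≈ε A
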